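{- Let $r$ be any positive integer and let $n = 8r$. Then there exists a $3$-choosable graph $G$ on $n$ vertices such that the largest induced $2$-choosable subgraph of $G$ has exactly $\frac{5n}{8}$ vertices.
   Context: A graph is $k$-choosable if for every assignment of a list of exactly $k$ colours to each vertex there is a proper vertex colouring in which every vertex receives a colour from its own list. -}

module Defs where

open import Data.Nat using (ℕ)
open import Data.Fin using (Fin)
open import Data.Bool using (Bool; true)
open import Data.List using (List; length)
open import Data.List.Membership.Propositional using (_∈_)
open import Data.List.Relation.Unary.Unique.Propositional using (Unique)
open import Data.Fin.Subset using (Subset; _∈_)
open import Data.Product using (Σ; _×_)
open import Relation.Binary.PropositionalEquality using (_≡_; _≢_)

record Graph (n : ℕ) : Set where
  field
    adj   : Fin n → Fin n → Bool
    sym   : ∀ u v → adj u v ≡ adj v u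
    irrefl : ∀ v → adj v v ≢ true

open Graph public

IsKListAssignmentOn : ∀ {n} → ℕ → Subset n → (Fin n → List ℕ) → Set
IsKListAssignmentOn k S L = ∀ v → v Data.Fin.Subset.∈ S → Unique (L v) × length (L v) ≡ k

InducedChoosable : ∀ {n} → ℕ → Graph n → Subset n → Set
InducedChoosable {n} k G S =
  (L : Fin n → List ℕ) → IsKListAssignmentOn k S L →
  Σ (Fin n → ℕ) λ c →
    (∀ v → v Data.Fin.Subset.∈ S → c v Data.List.Membership.Propositional.∈ L v) ×
    (∀ u v → u Data.Fin.Subset.∈ S → v Data.Fin.Subset.∈ S → adj G u v ≡ true → c u ≢ c v)

Choosable : ∀ {n} → ℕ → Graph n → Set
Choosable k G = InducedChoosable k G Data.Fin.Subset.⊤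

-- G is r disjoint copies of K₄,₄.  Choosability of an induced subgraph of a disjoint union is
-- decided copy by copy, so everything reduces to a single K₄,₄.  K₄,₄ is 3-choosable by the
-- Erdős–Rubin–Taylor splitting argument.  One vertex together with the opposite side is a star,
-- hence 2-choosable, which gives 5 vertices per copy.  Conversely, six vertices of K₄,₄ span a K₃,₃
-- or a K₂,₄, and neither is 2-choosable: for the lists 12, 13, 23 on both sides of K₃,₃, or 12, 34
-- against 13, 14, 23, 24 on K₂,₄, every choice of colours on one side uses up the whole list of a
-- vertex on the other side.

module Submission where

open import Data.Bool using (Bool; true; false; not; _∧_; _xor_; if_then_else_)
open import Data.Bool.ListAction using (all)
open import Data.Bool.Properties using (xor-same; xor-comm; ¬-not; not-involutive) renaming (_≟_ to _≟ᵇ_)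
open import Data.Empty using (⊥)
open import Data.Fin using (Fin; zero; suc; _↑ˡ_; _↑ʳ_; splitAt; combine; remQuot) renaming (_≟_ to _≟ᶠ_)
open import Data.Fin.Properties using (remQuot-combine; combine-remQuot; suc-injective;
  ↑ˡ-injective; ↑ʳ-injective; splitAt-↑ˡ; splitAt-↑ʳ)
open import Data.Fin.Subset using (Subset; ∣_∣; ⊤) renaming (_∈_ to _∈ₛ_)
open import Data.Fin.Subset.Properties using (∣p∣≤n; ∈⊤)
open import Data.List using (List; []; _∷_; _++_; map; length; cartesianProductWith; take; zip;
  filter; concat; allFin; upTo)
open import Data.List.Membership.Propositional using (_∈_; _∉_; find)
open import Data.List.Membership.Propositional.Properties using (∈-map⁺; ∈-map⁻; ∈-++⁺ˡ; ∈-++⁺ʳ;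
  ∈-cartesianProductWith⁺; ∈-filter⁻; ∈-concat⁺′; ∈-allFin)
open import Data.List.Properties using (map-++; length-++; length-map; length-upTo; map-∘; map-cong;
  filter-accept; filter-reject; filter-all)
open import Data.List.Relation.Unary.All as All using (All; []; _∷_; all?)
import Data.List.Relation.Unary.All.Properties as Allₚ
open import Data.List.Relation.Unary.AllPairs using ([]; _∷_)
open import Data.List.Relation.Unary.Any using (Any; here; there; any?)
open import Data.List.Relation.Unary.Unique.Propositional using (Unique)
import Data.List.Relation.Unary.Unique.Propositional.Properties as Uniqueₚ
open import Data.Nat using (ℕ; NonZero; zero; suc; _+_; _*_; _^_; _≤_; s≤s; z≤n; _≟_; _≤?_)
open import Data.Nat.ListAction using (sum)
open import Data.Nat.ListAction.Properties using (sum-++)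
open import Data.Nat.Properties using (+-identityʳ; +-mono-≤; *-comm; *-assoc; *-distribˡ-+;
  *-cancelˡ-≡; m+n≡0⇒m≡0; m+n≡0⇒n≡0; n≢0⇒n>0; ≤-refl; <-irrefl; m≤n⇒m≤1+n; ≰⇒>;
  +-commutativeSemigroup; +-*-semiring; module ≤-Reasoning)
open import Data.Product using (Σ; ∃; _×_; _,_; proj₁; proj₂)
open import Data.Sum using (_⊎_; inj₁; inj₂; [_,_])
open import Data.Vec using (Vec; []; _∷_; toList; tabulate)
  renaming (lookup to lookupᵛ; _++_ to _++ᵛ_; splitAt to splitAtᵛ)
import Data.Vec.Base as Vec using (here; there)
open import Data.Vec.Properties using (tabulate-cong; lookup∘tabulate; tabulate∘lookup;
  lookup-replicate; lookup-++ˡ; lookup-++ʳ; []=⇒lookup; lookup⇒[]=)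
open import Function using (case_of_)
open import Relation.Binary.PropositionalEquality using (_≡_; _≢_; refl; sym; trans; cong; cong₂;
  subst; module ≡-Reasoning)
open import Relation.Nullary using (¬_; ¬?; Dec; yes; no; does; contradiction)
open import Relation.Nullary.Decidable using (_×-dec_; from-yes)

open import Algebra.Properties.CommutativeSemigroup +-commutativeSemigroup
  using () renaming (interchange to +-interchange)
open import Algebra.Properties.Semiring.Sum +-*-semiring using (∑-distrib-+; sum-replicate-zero;
  sum-cong-≗; *-distribˡ-sum; sum-syntax)
open import Data.List.Membership.DecPropositional _≟_ using (_∈?_)
open import Data.List.Relation.Unary.Unique.DecPropositional _≟_ using (unique?)
open import Defs hiding (sym)

TwoList : List ℕ → Set
TwoList P = Unique P × length P ≡ 2

twoList? : ∀ P → Dec (TwoList P)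
twoList? P = unique? P ×-dec (length P ≟ 2)

ListColouring : ∀ {n} → Graph n → Subset n → (Fin n → List ℕ) → Set
ListColouring {n} G S L = Σ (Fin n → ℕ) λ c →
  (∀ v → v ∈ₛ S → c v ∈ L v) × (∀ u v → u ∈ₛ S → v ∈ₛ S → adj G u v ≡ true → c u ≢ c v)

twoList-01 : TwoList (0 ∷ 1 ∷ [])
twoList-01 = ((λ ()) ∷ []) ∷ [] ∷ [] , refl

-- Returns x itself when the list has no colour other than x.
otherThan : ℕ → List ℕ → ℕ
otherThan x [] = x
otherThan x (a ∷ as) with a ≟ x
... | yes _ = otherThan x as
... | no _ = a

otherThan-∈-≢ : ∀ x {P} → TwoList P → otherThan x P ∈ P × otherThan x P ≢ x
otherThan-∈-≢ x {a ∷ b ∷ []} (((a≢b ∷ []) ∷ _) , _) with a ≟ x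
... | no a≢x = here refl , a≢x
... | yes refl with b ≟ a
...   | yes refl = contradiction refl a≢b
...   | no b≢a = there (here refl) , b≢a

-- Two-choosability of stars, and two obstructions to it

star-choosable : ∀ {n} (G : Graph n) (S : Subset n) (z : Fin n) →
  (∀ u v → u ∈ₛ S → v ∈ₛ S → adj G u v ≡ true → u ≡ z ⊎ v ≡ z) →
  InducedChoosable 2 G S
star-choosable {n} G S z centred L L-two = c , c∈L , proper
  where
  centre : ℕ
  centre = otherThan 0 (L z)

  c : Fin n → ℕ
  c v with v ≟ᶠ z
  ... | yes _ = centre
  ... | no _ = otherThan centre (L v)

  c-centre : c z ≡ centre
  c-centre with z ≟ᶠ z
  ... | yes _ = refl
  ... | no z≢z = contradiction refl z≢z

  c-leaf : ∀ {v} → v ∈ₛ S → v ≢ z → c v ∈ L v × c v ≢ centre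
  c-leaf {v} v∈S v≢z with v ≟ᶠ z
  ... | yes v≡z = contradiction v≡z v≢z
  ... | no _ = otherThan-∈-≢ centre (L-two v v∈S)

  c∈L : ∀ v → v ∈ₛ S → c v ∈ L v
  c∈L v v∈S = centre-or-leaf (v ≟ᶠ z)
    where
    centre-or-leaf : Dec (v ≡ z) → c v ∈ L v
    centre-or-leaf (yes refl) = subst (_∈ L z) (sym c-centre) (proj₁ (otherThan-∈-≢ 0 (L-two z v∈S)))
    centre-or-leaf (no v≢z) = proj₁ (c-leaf v∈S v≢z)

  leaf≢centre : ∀ {v} → v ∈ₛ S → adj G z v ≡ true → c v ≢ c z
  leaf≢centre {v} v∈S zv rewrite c-centre = proj₂ (c-leaf v∈S λ { refl → irrefl G z zv })

  proper : ∀ u v → u ∈ₛ S → v ∈ₛ S → adj G u v ≡ true → c u ≢ c v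
  proper u v u∈S v∈S uv with centred u v u∈S v∈S uv
  ... | inj₁ refl = λ cu≡cv → leaf≢centre v∈S uv (sym cu≡cv)
  ... | inj₂ refl = leaf≢centre u∈S (trans (Graph.sym G v u) uv)

lookupOr : ∀ {n} → List ℕ → List (Fin n × List ℕ) → Fin n → List ℕ
lookupOr d [] v = d
lookupOr d ((x , P) ∷ tbl) v with v ≟ᶠ x
... | yes _ = P
... | no _ = lookupOr d tbl v

lookupOr-∈ : ∀ {n} d {tbl : List (Fin n × List ℕ)} {x P} →
  Unique (map proj₁ tbl) → (x , P) ∈ tbl → lookupOr d tbl x ≡ P
lookupOr-∈ d {(x , P) ∷ _} _ (here refl) with x ≟ᶠ x
... | yes _ = refl
... | no x≢x = contradiction refl x≢x
lookupOr-∈ d {(y , _) ∷ _} {x} (y∉tbl ∷ u) (there m) with x ≟ᶠ y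
... | yes refl = contradiction refl (All.lookup y∉tbl (∈-map⁺ proj₁ m))
... | no _ = lookupOr-∈ d u m

lookupOr-All : ∀ {n} {Q : List ℕ → Set} d (tbl : List (Fin n × List ℕ)) →
  Q d → All Q (map proj₂ tbl) → ∀ v → Q (lookupOr d tbl v)
lookupOr-All d [] Qd _ v = Qd
lookupOr-All d ((x , P) ∷ tbl) Qd (QP ∷ Qtbl) v with v ≟ᶠ x
... | yes _ = QP
... | no _ = lookupOr-All d tbl Qd Qtbl v

choices : List (List ℕ) → List (List ℕ)
choices [] = [] ∷ []
choices (P ∷ Ps) = cartesianProductWith _∷_ P (choices Ps)

choices-∈ : ∀ {A : Set} (f : A → ℕ) (ls : List (A × List ℕ)) →
  All (λ xP → f (proj₁ xP) ∈ proj₂ xP) ls → map (λ xP → f (proj₁ xP)) ls ∈ choices (map proj₂ ls)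
choices-∈ f [] [] = here refl
choices-∈ f (_ ∷ ls) (fx∈P ∷ rest) = ∈-cartesianProductWith⁺ _∷_ fx∈P (choices-∈ f ls rest)

Covers : List (List ℕ) → List (List ℕ) → Set
Covers Ps Qs = All (λ as → Any (λ Q → All (_∈ as) Q) Qs) (choices Ps)

covers? : ∀ Ps Qs → Dec (Covers Ps Qs)
covers? Ps Qs = all? (λ as → any? (all? (_∈? as)) Qs) (choices Ps)

-- The colours picked on ls exhaust the list of some vertex of rs, which is adjacent to all of ls.
biclique-obstruction : ∀ {n} (G : Graph n) (S : Subset n) (ls rs : List (Fin n × List ℕ)) →
  Unique (map proj₁ ls) → Unique (map proj₁ rs) →
  All (_∈ₛ S) (map proj₁ ls) → All (_∈ₛ S) (map proj₁ rs) →
  (∀ {x y} → x ∈ map proj₁ ls → y ∈ map proj₁ rs → adj G x y ≡ true) →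
  All TwoList (map proj₂ (ls ++ rs)) → Covers (map proj₂ ls) (map proj₂ rs) →
  ¬ InducedChoosable 2 G S
biclique-obstruction G S ls rs ls-unique rs-unique ls⊆S rs⊆S adjacent two covers ic
  with ic (lookupOr (0 ∷ 1 ∷ []) (ls ++ rs)) (λ v _ → lookupOr-All _ (ls ++ rs) twoList-01 two v)
... | c , c∈L , proper = conflict
  where
  keys-unique : Unique (map proj₁ (ls ++ rs))
  keys-unique = subst Unique (sym (map-++ proj₁ ls rs))
    (Uniqueₚ.++⁺ ls-unique rs-unique λ (x∈ls , x∈rs) → irrefl G _ (adjacent x∈ls x∈rs))

  c∈table : ∀ {x P} → (x , P) ∈ ls ++ rs → x ∈ₛ S → c x ∈ P
  c∈table {x} m x∈S = subst (c x ∈_) (lookupOr-∈ _ keys-unique m) (c∈L x x∈S)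

  picked : List ℕ
  picked = map (λ xP → c (proj₁ xP)) ls

  picked-choice : picked ∈ choices (map proj₂ ls)
  picked-choice = choices-∈ c ls (All.tabulate λ m →
    c∈table (∈-++⁺ˡ m) (All.lookup ls⊆S (∈-map⁺ proj₁ m)))

  conflict : ⊥
  conflict with find (All.lookup covers picked-choice)
  ... | Q , Q∈rs , Q⊆picked with ∈-map⁻ proj₂ Q∈rs
  ... | (y , _) , yQ∈rs , refl with ∈-map⁻ (λ xP → c (proj₁ xP)) (All.lookup Q⊆picked
          (c∈table (∈-++⁺ʳ ls yQ∈rs) (All.lookup rs⊆S (∈-map⁺ proj₁ yQ∈rs))))
  ... | (x , _) , xP∈ls , cy≡cx =
    proper x y (All.lookup ls⊆S (∈-map⁺ proj₁ xP∈ls)) (All.lookup rs⊆S (∈-map⁺ proj₁ yQ∈rs))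
      (adjacent (∈-map⁺ proj₁ xP∈ls) (∈-map⁺ proj₁ yQ∈rs)) (sym cy≡cx)

splitPrefix : ∀ {A : Set} k (xs : List A) → k ≤ length xs →
  Σ (Vec A k) λ ys → Σ (List A) λ zs → xs ≡ toList ys ++ zs
splitPrefix zero xs _ = [] , xs , refl
splitPrefix (suc k) (x ∷ xs) (s≤s k≤xs) with splitPrefix k xs k≤xs
... | ys , zs , refl = x ∷ ys , zs , refl

Biclique : ∀ {n} → Graph n → Subset n → List (Fin n) → List (Fin n) → Set
Biclique G S xs ys = Unique xs × Unique ys × All (_∈ₛ S) xs × All (_∈ₛ S) ys ×
  (∀ {x y} → x ∈ xs → y ∈ ys → adj G x y ≡ true)

Biclique-swap : ∀ {n} {G : Graph n} {S xs ys} → Biclique G S xs ys → Biclique G S ys xs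
Biclique-swap {G = G} (uxs , uys , xs⊆S , ys⊆S , adjacent) =
  uys , uxs , ys⊆S , xs⊆S , λ {y} {x} y∈ys x∈xs → trans (Graph.sym G y x) (adjacent x∈xs y∈ys)

-- The colour lists of the classical non-2-choosable list assignments of K₃,₃ and K₂,₄.
pairs-of-three : List (List ℕ)
pairs-of-three = (1 ∷ 2 ∷ []) ∷ (1 ∷ 3 ∷ []) ∷ (2 ∷ 3 ∷ []) ∷ []

two-disjoint-pairs : List (List ℕ)
two-disjoint-pairs = (1 ∷ 2 ∷ []) ∷ (3 ∷ 4 ∷ []) ∷ []

transversals : List (List ℕ)
transversals = (1 ∷ 3 ∷ []) ∷ (1 ∷ 4 ∷ []) ∷ (2 ∷ 3 ∷ []) ∷ (2 ∷ 4 ∷ []) ∷ []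

K33-not-2-choosable : ∀ {n} (G : Graph n) (S : Subset n) (xs ys : List (Fin n)) → Biclique G S xs ys →
  3 ≤ length xs → 3 ≤ length ys → ¬ InducedChoosable 2 G S
K33-not-2-choosable G S xs ys (uxs , uys , xs⊆S , ys⊆S , adjacent) 3≤xs 3≤ys
  with splitPrefix 3 xs 3≤xs | splitPrefix 3 ys 3≤ys
... | x₁ ∷ x₂ ∷ x₃ ∷ [] , _ , refl | y₁ ∷ y₂ ∷ y₃ ∷ [] , _ , refl =
  biclique-obstruction G S
    (zip (x₁ ∷ x₂ ∷ x₃ ∷ []) pairs-of-three) (zip (y₁ ∷ y₂ ∷ y₃ ∷ []) pairs-of-three)
    (Uniqueₚ.take⁺ 3 uxs) (Uniqueₚ.take⁺ 3 uys) (Allₚ.take⁺ 3 xs⊆S) (Allₚ.take⁺ 3 ys⊆S)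
    (λ x∈ y∈ → adjacent (∈-++⁺ˡ x∈) (∈-++⁺ˡ y∈))
    (from-yes (all? twoList? (pairs-of-three ++ pairs-of-three)))
    (from-yes (covers? pairs-of-three pairs-of-three))

K24-not-2-choosable : ∀ {n} (G : Graph n) (S : Subset n) (xs ys : List (Fin n)) → Biclique G S xs ys →
  2 ≤ length xs → 4 ≤ length ys → ¬ InducedChoosable 2 G S
K24-not-2-choosable G S xs ys (uxs , uys , xs⊆S , ys⊆S , adjacent) 2≤xs 4≤ys
  with splitPrefix 2 xs 2≤xs | splitPrefix 4 ys 4≤ys
... | x₁ ∷ x₂ ∷ [] , _ , refl | y₁ ∷ y₂ ∷ y₃ ∷ y₄ ∷ [] , _ , refl =
  biclique-obstruction G S
    (zip (x₁ ∷ x₂ ∷ []) two-disjoint-pairs) (zip (y₁ ∷ y₂ ∷ y₃ ∷ y₄ ∷ []) transversals)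
    (Uniqueₚ.take⁺ 2 uxs) (Uniqueₚ.take⁺ 4 uys) (Allₚ.take⁺ 2 xs⊆S) (Allₚ.take⁺ 4 ys⊆S)
    (λ x∈ y∈ → adjacent (∈-++⁺ˡ x∈) (∈-++⁺ˡ y∈))
    (from-yes (all? twoList? (two-disjoint-pairs ++ transversals)))
    (from-yes (covers? two-disjoint-pairs transversals))

members : ∀ {n} → Subset n → List (Fin n)
members [] = []
members (true ∷ p) = zero ∷ map suc (members p)
members (false ∷ p) = map suc (members p)

members-length : ∀ {n} (p : Subset n) → length (members p) ≡ ∣ p ∣
members-length [] = refl
members-length (true ∷ p) = cong suc (trans (length-map suc (members p)) (members-length p))
members-length (false ∷ p) = trans (length-map suc (members p)) (members-length p)

members-∈ : ∀ {n} (p : Subset n) → All (_∈ₛ p) (members p)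
members-∈ [] = []
members-∈ (true ∷ p) = Vec.here ∷ Allₚ.map⁺ (All.map Vec.there (members-∈ p))
members-∈ (false ∷ p) = Allₚ.map⁺ (All.map Vec.there (members-∈ p))

members-unique : ∀ {n} (p : Subset n) → Unique (members p)
members-unique [] = []
members-unique (true ∷ p) =
  Allₚ.map⁺ (All.universal (λ _ ()) (members p)) ∷ Uniqueₚ.map⁺ suc-injective (members-unique p)
members-unique (false ∷ p) = Uniqueₚ.map⁺ suc-injective (members-unique p)

∣++∣ : ∀ {m n} (p : Subset m) (q : Subset n) → ∣ p ++ᵛ q ∣ ≡ ∣ p ∣ + ∣ q ∣
∣++∣ [] q = refl
∣++∣ (true ∷ p) q = cong suc (∣++∣ p q)
∣++∣ (false ∷ p) q = ∣++∣ p q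

∈-++ˡ : ∀ {m n} {p : Subset m} (q : Subset n) {x} → x ∈ₛ p → x ↑ˡ n ∈ₛ p ++ᵛ q
∈-++ˡ {p = p} q {x} x∈p = lookup⇒[]= _ _ (trans (lookup-++ˡ p q x) ([]=⇒lookup x∈p))

∈-++ʳ : ∀ {m n} (p : Subset m) {q : Subset n} {y} → y ∈ₛ q → m ↑ʳ y ∈ₛ p ++ᵛ q
∈-++ʳ p {q} {y} y∈q = lookup⇒[]= _ _ (trans (lookup-++ʳ p q y) ([]=⇒lookup y∈q))

∣∷∣ : ∀ {n} b (p : Subset n) → ∣ b ∷ p ∣ ≡ ∣ b ∷ [] ∣ + ∣ p ∣
∣∷∣ true p = refl
∣∷∣ false p = refl

∣p∣≡∑ : ∀ {n} (p : Subset n) → ∣ p ∣ ≡ ∑[ i < n ] ∣ lookupᵛ p i ∷ [] ∣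
∣p∣≡∑ [] = refl
∣p∣≡∑ (b ∷ p) = trans (∣∷∣ b p) (cong (∣ b ∷ [] ∣ +_) (∣p∣≡∑ p))

sumOver : ∀ {A : Set} → List A → (A → ℕ) → ℕ
sumOver xs f = sum (map f xs)

sumOver-++ : ∀ {A : Set} (xs ys : List A) f → sumOver (xs ++ ys) f ≡ sumOver xs f + sumOver ys f
sumOver-++ xs ys f = trans (cong sum (map-++ f xs ys)) (sum-++ (map f xs) (map f ys))

sumOver-map : ∀ {A B : Set} (g : A → B) (xs : List A) f → sumOver (map g xs) f ≡ sumOver xs (λ x → f (g x))
sumOver-map g xs f = cong sum (sym (map-∘ xs))

sumOver-cong : ∀ {A : Set} (xs : List A) {f g} → (∀ x → f x ≡ g x) → sumOver xs f ≡ sumOver xs g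
sumOver-cong xs f≗g = cong sum (map-cong f≗g xs)

sumOver-+ : ∀ {A : Set} (xs : List A) f g → sumOver xs (λ x → f x + g x) ≡ sumOver xs f + sumOver xs g
sumOver-+ [] f g = refl
sumOver-+ (x ∷ xs) f g rewrite sumOver-+ xs f g = +-interchange (f x) (g x) (sumOver xs f) (sumOver xs g)

sumOver-∑ : ∀ {A : Set} {k} (xs : List A) (f : Fin k → A → ℕ) →
  sumOver xs (λ x → ∑[ i < k ] f i x) ≡ ∑[ i < k ] sumOver xs (f i)
sumOver-∑ {k = k} [] f = sym (sum-replicate-zero k)
sumOver-∑ (x ∷ xs) f rewrite sumOver-∑ xs f = sym (∑-distrib-+ (λ i → f i x) (λ i → sumOver xs (f i)))

sum≥length : ∀ {A : Set} (xs : List A) f → All (λ x → 1 ≤ f x) xs → length xs ≤ sumOver xs f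
sum≥length [] f [] = z≤n
sum≥length (x ∷ xs) f (1≤fx ∷ rest) = +-mono-≤ 1≤fx (sum≥length xs f rest)

sum>length : ∀ {A : Set} {x₀} (xs : List A) f → All (λ x → 1 ≤ f x) xs → x₀ ∈ xs → 2 ≤ f x₀ →
  suc (length xs) ≤ sumOver xs f
sum>length (x ∷ xs) f (_ ∷ rest) (here refl) 2≤fx = +-mono-≤ 2≤fx (sum≥length xs f rest)
sum>length (x ∷ xs) f (1≤fx ∷ rest) (there x₀∈xs) 2≤fx₀ =
  +-mono-≤ 1≤fx (sum>length xs f rest x₀∈xs 2≤fx₀)

average-one⇒zero : ∀ {A : Set} {x₀} (xs : List A) f →
  sumOver xs f ≡ length xs → x₀ ∈ xs → 2 ≤ f x₀ → ∃ λ x → x ∈ xs × f x ≡ 0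
average-one⇒zero xs f sum≡length x₀∈xs 2≤fx₀ with any? (λ x → f x ≟ 0) xs
... | yes some-zero = find some-zero
... | no no-zero = contradiction (subst (_ ≤_) sum≡length (sum>length xs f
  (All.map n≢0⇒n>0 (Allₚ.¬Any⇒All¬ xs no-zero)) x₀∈xs 2≤fx₀)) (<-irrefl refl)

∑≡0⇒ : ∀ {k} (f : Fin k → ℕ) → ∑[ i < k ] f i ≡ 0 → ∀ i → f i ≡ 0
∑≡0⇒ f ∑≡0 zero = m+n≡0⇒m≡0 (f zero) ∑≡0
∑≡0⇒ f ∑≡0 (suc i) = ∑≡0⇒ (λ i → f (suc i)) (m+n≡0⇒n≡0 (f zero) ∑≡0) i

∑-const : ∀ k c → ∑[ i < k ] c ≡ k * c
∑-const zero c = refl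
∑-const (suc k) c = cong (c +_) (∑-const k c)

∑-equal-shares : ∀ {k} .{{_ : NonZero k}} (f : Fin k → ℕ) N →
  (∀ i → k * f i ≡ N) → ∑[ i < k ] f i ≡ N
∑-equal-shares {k} f N shares = *-cancelˡ-≡ _ N k (begin
  k * ∑[ i < k ] f i   ≡⟨ *-distribˡ-sum k f ⟩
  ∑[ i < k ] (k * f i) ≡⟨ sum-cong-≗ shares ⟩
  ∑[ i < k ] N         ≡⟨ ∑-const k N ⟩
  k * N ∎)
  where open ≡-Reasoning

∑-mono-≤ : ∀ {k} {f g : Fin k → ℕ} → (∀ i → f i ≤ g i) → ∑[ i < k ] f i ≤ ∑[ i < k ] g i
∑-mono-≤ {zero} _ = z≤n
∑-mono-≤ {suc k} f≤g = +-mono-≤ (f≤g zero) (∑-mono-≤ (λ i → f≤g (suc i)))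

-- Splittings of a set of colours

update : ℕ → Bool → (ℕ → Bool) → ℕ → Bool
update u b X e with e ≟ u
... | yes _ = b
... | no _ = X e

update-≢ : ∀ {u e} b X → e ≢ u → update u b X e ≡ X e
update-≢ {u} {e} b X e≢u with e ≟ u
... | yes e≡u = contradiction e≡u e≢u
... | no _ = refl

update-≡ : ∀ u b X → update u b X u ≡ b
update-≡ u b X with u ≟ u
... | yes _ = refl
... | no u≢u = contradiction refl u≢u

-- Colours outside U stay false; a repeated colour in U merely repeats splittings.
splittings : List ℕ → List (ℕ → Bool)
splittings [] = (λ _ → false) ∷ []
splittings (u ∷ U) = map (update u true) (splittings U) ++ map (update u false) (splittings U)

sumOver-splittings : ∀ u U g → sumOver (splittings (u ∷ U)) g ≡
  sumOver (splittings U) (λ X → g (update u true X) + g (update u false X))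
sumOver-splittings u U g = begin
  sumOver (splittings (u ∷ U)) g
    ≡⟨ sumOver-++ (map (update u true) (splittings U)) _ g ⟩
  sumOver (map (update u true) (splittings U)) g + sumOver (map (update u false) (splittings U)) g
    ≡⟨ cong₂ _+_ (sumOver-map (update u true) (splittings U) g)
                 (sumOver-map (update u false) (splittings U) g) ⟩
  sumOver (splittings U) (λ X → g (update u true X)) + sumOver (splittings U) (λ X → g (update u false X))
    ≡⟨ sumOver-+ (splittings U) _ _ ⟨
  sumOver (splittings U) (λ X → g (update u true X) + g (update u false X)) ∎
  where open ≡-Reasoning

all-marked : ∀ U → Σ (ℕ → Bool) λ X → X ∈ splittings U × (∀ {e} → e ∈ U → X e ≡ true)
all-marked [] = _ , here refl , λ ()
all-marked (u ∷ U) with all-marked U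
... | X , X∈ , X-true = update u true X , ∈-++⁺ˡ (∈-map⁺ (update u true) X∈) , marked
  where
  marked : ∀ {e} → e ∈ u ∷ U → update u true X e ≡ true
  marked (here refl) = update-≡ u true X
  marked {e} (there e∈U) with e ≟ u
  ... | yes _ = refl
  ... | no _ = X-true e∈U

length-splittings : ∀ U → length (splittings U) ≡ 2 ^ length U
length-splittings [] = refl
length-splittings (u ∷ U) = begin
  length (map (update u true) (splittings U) ++ map (update u false) (splittings U))
    ≡⟨ length-++ (map (update u true) (splittings U)) ⟩
  length (map (update u true) (splittings U)) + length (map (update u false) (splittings U))
    ≡⟨ cong₂ _+_ (length-map _ (splittings U)) (length-map _ (splittings U)) ⟩
  length (splittings U) + length (splittings U)
    ≡⟨ cong₂ _+_ (length-splittings U) (trans (length-splittings U) (sym (+-identityʳ _))) ⟩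
  2 ^ length (u ∷ U) ∎
  where open ≡-Reasoning

remove : ℕ → List ℕ → List ℕ
remove u = filter (λ e → ¬? (e ≟ u))

remove-head : ∀ {u xs} → Unique (u ∷ xs) → remove u (u ∷ xs) ≡ xs
remove-head {u} {xs} (u∉xs ∷ _) = trans (filter-reject (λ e → ¬? (e ≟ u)) (λ u≢u → u≢u refl))
  (filter-all (λ e → ¬? (e ≟ u)) (All.map (λ u≢e e≡u → u≢e (sym e≡u)) u∉xs))

remove-⊆ : ∀ {u e} E → e ∈ remove u E → e ∈ E × e ≢ u
remove-⊆ {u} E = ∈-filter⁻ (λ e → ¬? (e ≟ u))

length-remove : ∀ {u E} → Unique E → u ∈ E → length E ≡ suc (length (remove u E))
length-remove uE (here refl) = cong suc (cong length (sym (remove-head uE)))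
length-remove {u} {x ∷ xs} (x∉xs ∷ uxs) (there u∈xs) with x ≟ u
... | yes refl = contradiction refl (All.lookup x∉xs u∈xs)
... | no x≢u = cong suc (trans (length-remove uxs u∈xs)
                 (cong length (sym (filter-accept (λ e → ¬? (e ≟ u)) x≢u))))

all-cong : ∀ {A : Set} (p q : A → Bool) E → (∀ {e} → e ∈ E → p e ≡ q e) → all p E ≡ all q E
all-cong p q [] _ = refl
all-cong p q (e ∷ E) p≗q = cong₂ _∧_ (p≗q (here refl)) (all-cong p q E (λ e∈E → p≗q (there e∈E)))

all-remove : ∀ p {u E} → Unique E → u ∈ E → all p E ≡ p u ∧ all p (remove u E)
all-remove p uE (here refl) rewrite remove-head uE = refl
all-remove p {u} {x ∷ xs} (x∉xs ∷ uxs) (there u∈xs) with x ≟ u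
... | yes refl = contradiction refl (All.lookup x∉xs u∈xs)
... | no x≢u rewrite filter-accept (λ e → ¬? (e ≟ u)) {xs = xs} x≢u | all-remove p uxs u∈xs =
  ∧-left-comm (p x) (p u) (all p (remove u xs))
  where
  ∧-left-comm : ∀ a b c → a ∧ (b ∧ c) ≡ b ∧ (a ∧ c)
  ∧-left-comm true b c = refl
  ∧-left-comm false true c = refl
  ∧-left-comm false false c = refl

indicator : Bool → ℕ
indicator t = if t then 1 else 0

uniform : Bool → List ℕ → (ℕ → Bool) → ℕ
uniform b E X = indicator (all (λ e → does (X e ≟ᵇ b)) E)

uniform-pair-∉ : ∀ b {u E} X → u ∉ E →
  uniform b E (update u true X) + uniform b E (update u false X) ≡ uniform b E X + uniform b E X
uniform-pair-∉ b {u} {E} X u∉E = cong₂ _+_ (unchanged true) (unchanged false)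
  where
  unchanged : ∀ v → uniform b E (update u v X) ≡ uniform b E X
  unchanged v = cong indicator (all-cong _ _ E λ {e} e∈E →
    cong (λ x → does (x ≟ᵇ b)) (update-≢ v X λ { refl → u∉E e∈E }))

uniform-pair-∈ : ∀ b {u E} X → Unique E → u ∈ E →
  uniform b E (update u true X) + uniform b E (update u false X) ≡ uniform b (remove u E) X
uniform-pair-∈ b {u} {E} X uE u∈E =
  trans (cong₂ _+_ (cong indicator (split true)) (cong indicator (split false))) (one-of b _)
  where
  split : ∀ v → all (λ e → does (update u v X e ≟ᵇ b)) E ≡
    does (v ≟ᵇ b) ∧ all (λ e → does (X e ≟ᵇ b)) (remove u E)
  split v = trans (all-remove _ uE u∈E) (cong₂ _∧_ (cong (λ x → does (x ≟ᵇ b)) (update-≡ u v X))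
    (all-cong _ _ (remove u E) λ e∈ →
      cong (λ x → does (x ≟ᵇ b)) (update-≢ v X (proj₂ (remove-⊆ E e∈)))))

  one-of : ∀ b r → indicator (does (true ≟ᵇ b) ∧ r) + indicator (does (false ≟ᵇ b) ∧ r) ≡ indicator r
  one-of true r = +-identityʳ _
  one-of false r = refl

all-true : ∀ {A : Set} (p : A → Bool) E → (∀ {e} → e ∈ E → p e ≡ true) → all p E ≡ true
all-true p [] _ = refl
all-true p (e ∷ E) p-true rewrite p-true (here refl) = all-true p E (λ e∈E → p-true (there e∈E))

uniform≡0⇒ : ∀ b E X → uniform b E X ≡ 0 → ∃ λ e → e ∈ E × X e ≡ not b
uniform≡0⇒ b (e ∷ E) X unif≡0 with X e ≟ᵇ b
... | yes _ = let e′ , e′∈E , Xe′ = uniform≡0⇒ b E X unif≡0 in e′ , there e′∈E , Xe′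
... | no Xe≢b = e , here refl , ¬-not Xe≢b

∈-tail : ∀ {A : Set} {e u : A} {U} → e ∈ u ∷ U → e ≢ u → e ∈ U
∈-tail (here e≡u) e≢u = contradiction e≡u e≢u
∈-tail (there e∈U) _ = e∈U

uniform-count : ∀ b U E → Unique E → (∀ {e} → e ∈ E → e ∈ U) →
  2 ^ length E * sumOver (splittings U) (uniform b E) ≡ 2 ^ length U
uniform-count b [] [] _ _ = refl
uniform-count b [] (e ∷ E) _ E⊆U with E⊆U (here refl)
... | ()
uniform-count b (u ∷ U) E uE E⊆U with u ∈? E
... | no u∉E = begin
  2 ^ length E * sumOver (splittings (u ∷ U)) (uniform b E)
    ≡⟨ cong (2 ^ length E *_) (trans (sumOver-splittings u U _)
         (trans (sumOver-cong (splittings U) (λ X → uniform-pair-∉ b X u∉E))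
                (sumOver-+ (splittings U) _ _))) ⟩
  2 ^ length E * (S + S)
    ≡⟨ *-distribˡ-+ (2 ^ length E) S S ⟩
  2 ^ length E * S + 2 ^ length E * S
    ≡⟨ cong₂ _+_ IH IH ⟩
  2 ^ length U + 2 ^ length U
    ≡⟨ cong (2 ^ length U +_) (sym (+-identityʳ _)) ⟩
  2 ^ length (u ∷ U) ∎
  where
  open ≡-Reasoning
  S : ℕ
  S = sumOver (splittings U) (uniform b E)
  IH : 2 ^ length E * S ≡ 2 ^ length U
  IH = uniform-count b U E uE λ e∈E → ∈-tail (E⊆U e∈E) λ { refl → u∉E e∈E }
... | yes u∈E = begin
  2 ^ length E * sumOver (splittings (u ∷ U)) (uniform b E)
    ≡⟨ cong₂ _*_ (cong (2 ^_) (length-remove uE u∈E))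
         (trans (sumOver-splittings u U _) (sumOver-cong (splittings U) (λ X → uniform-pair-∈ b X uE u∈E))) ⟩
  2 * 2 ^ length E′ * sumOver (splittings U) (uniform b E′)
    ≡⟨ *-assoc 2 (2 ^ length E′) _ ⟩
  2 * (2 ^ length E′ * sumOver (splittings U) (uniform b E′))
    ≡⟨ cong (2 *_) (uniform-count b U E′ (Uniqueₚ.filter⁺ (λ e → ¬? (e ≟ u)) uE) E′⊆U) ⟩
  2 ^ length (u ∷ U) ∎
  where
  open ≡-Reasoning
  E′ : List ℕ
  E′ = remove u E
  E′⊆U : ∀ {e} → e ∈ E′ → e ∈ U
  E′⊆U e∈E′ = let e∈E , e≢u = remove-⊆ E e∈E′ in ∈-tail (E⊆U e∈E) e≢u

-- K₄,₄

-- The sides of K₄,₄ on Fin 8 = Fin (4 + 4) are the images of _↑ˡ 4 and 4 ↑ʳ_.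
side : Fin 8 → Bool
side p = [ (λ _ → false) , (λ _ → true) ] (splitAt 4 p)

K44 : Graph 8
K44 = record
  { adj = λ p q → side p xor side q
  ; sym = λ p q → xor-comm (side p) (side q)
  ; irrefl = λ p p~p → case trans (sym (xor-same (side p))) p~p of λ ()
  }

left-right-adjacent : ∀ a b → adj K44 (a ↑ˡ 4) (4 ↑ʳ b) ≡ true
left-right-adjacent a b rewrite splitAt-↑ˡ 4 a 4 | splitAt-↑ʳ 4 4 b = refl

K44-parts : ∀ (A B : Subset 4) →
  Biclique K44 (A ++ᵛ B) (map (_↑ˡ 4) (members A)) (map (4 ↑ʳ_) (members B))
K44-parts A B =
  Uniqueₚ.map⁺ (↑ˡ-injective 4 _ _) (members-unique A) ,
  Uniqueₚ.map⁺ (↑ʳ-injective 4 _ _) (members-unique B) ,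
  Allₚ.map⁺ (All.map (∈-++ˡ B) (members-∈ A)) ,
  Allₚ.map⁺ (All.map (∈-++ʳ A) (members-∈ B)) ,
  adjacent
  where
  adjacent : ∀ {x y} → x ∈ map (_↑ˡ 4) (members A) → y ∈ map (4 ↑ʳ_) (members B) → adj K44 x y ≡ true
  adjacent x∈ y∈ with ∈-map⁻ (_↑ˡ 4) x∈ | ∈-map⁻ (4 ↑ʳ_) y∈
  ... | a , _ , refl | b , _ , refl = left-right-adjacent a b

part-sizes : ∀ {a b} → a ≤ 4 → b ≤ 4 →
  a + b ≤ 5 ⊎ (3 ≤ a × 3 ≤ b) ⊎ (2 ≤ a × 4 ≤ b) ⊎ (4 ≤ a × 2 ≤ b)
part-sizes z≤n b≤4 = inj₁ (m≤n⇒m≤1+n b≤4)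
part-sizes (s≤s z≤n) b≤4 = inj₁ (s≤s b≤4)
part-sizes {b = b} (s≤s (s≤s z≤n)) _ with b ≤? 3
... | yes b≤3 = inj₁ (s≤s (s≤s b≤3))
... | no b≰3 = inj₂ (inj₂ (inj₁ (s≤s (s≤s z≤n) , ≰⇒> b≰3)))
part-sizes {b = b} (s≤s (s≤s (s≤s z≤n))) _ with b ≤? 2
... | yes b≤2 = inj₁ (s≤s (s≤s (s≤s b≤2)))
... | no b≰2 = inj₂ (inj₁ (≤-refl , ≰⇒> b≰2))
part-sizes {b = b} (s≤s (s≤s (s≤s (s≤s z≤n)))) _ with b ≤? 1
... | yes b≤1 = inj₁ (s≤s (s≤s (s≤s (s≤s b≤1))))
... | no b≰1 = inj₂ (inj₂ (inj₂ (≤-refl , ≰⇒> b≰1)))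

≤-members : ∀ {k m n} (f : Fin m → Fin n) (p : Subset m) →
  k ≤ ∣ p ∣ → k ≤ length (map f (members p))
≤-members f p = subst (_ ≤_) (sym (trans (length-map f (members p)) (members-length p)))

K44-2-choosable-bound : ∀ T → InducedChoosable 2 K44 T → ∣ T ∣ ≤ 5
K44-2-choosable-bound T ic with splitAtᵛ 4 T
... | A , B , refl rewrite ∣++∣ A B with part-sizes (∣p∣≤n A) (∣p∣≤n B)
... | inj₁ small = small
... | inj₂ (inj₁ (3≤A , 3≤B)) =
  contradiction ic (K33-not-2-choosable K44 _ _ _ (K44-parts A B) (≤-members _ A 3≤A) (≤-members _ B 3≤B))
... | inj₂ (inj₂ (inj₁ (2≤A , 4≤B))) =
  contradiction ic (K24-not-2-choosable K44 _ _ _ (K44-parts A B) (≤-members _ A 2≤A) (≤-members _ B 4≤B))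
... | inj₂ (inj₂ (inj₂ (4≤A , 2≤B))) =
  contradiction ic (K24-not-2-choosable K44 _ _ _ (Biclique-swap {G = K44} (K44-parts A B))
    (≤-members _ B 2≤B) (≤-members _ A 4≤A))

-- One vertex of the first side together with the whole second side: a star K₁,₄.
K44-star : Subset 8
K44-star = true ∷ false ∷ false ∷ false ∷ true ∷ true ∷ true ∷ true ∷ []

K44-star-leaf-side : ∀ p → suc p ∈ₛ K44-star → side (suc p) ≡ true
K44-star-leaf-side zero (Vec.there ())
K44-star-leaf-side (suc zero) (Vec.there (Vec.there ()))
K44-star-leaf-side (suc (suc zero)) (Vec.there (Vec.there (Vec.there ())))
K44-star-leaf-side (suc (suc (suc zero))) _ = refl
K44-star-leaf-side (suc (suc (suc (suc zero)))) _ = refl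
K44-star-leaf-side (suc (suc (suc (suc (suc zero))))) _ = refl
K44-star-leaf-side (suc (suc (suc (suc (suc (suc zero)))))) _ = refl

K44-star-2-choosable : InducedChoosable 2 K44 K44-star
K44-star-2-choosable = star-choosable K44 K44-star zero centred
  where
  centred : ∀ u v → u ∈ₛ K44-star → v ∈ₛ K44-star → adj K44 u v ≡ true → u ≡ zero ⊎ v ≡ zero
  centred zero _ _ _ _ = inj₁ refl
  centred (suc _) zero _ _ _ = inj₂ refl
  centred (suc p) (suc q) p∈ q∈ pq
    rewrite K44-star-leaf-side p p∈ | K44-star-leaf-side q q∈ = case pq of λ ()

-- Erdős–Rubin–Taylor: split the colours at random between the two sides; a vertex is stuck when all
-- three of its colours go to the other side, which happens with probability 1/8.  So on average one
-- of the eight vertices is stuck, while marking every colour for the second side strands all four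
-- vertices of the first side; hence some splitting strands no vertex.
K44-3-choosable : Choosable 3 K44
K44-3-choosable L L-three = c , (λ p _ → c∈L p) , proper
  where
  U : List ℕ
  U = concat (map L (allFin 8))

  stuck : Fin 8 → (ℕ → Bool) → ℕ
  stuck p = uniform (not (side p)) (L p)

  stuck-count : (ℕ → Bool) → ℕ
  stuck-count X = ∑[ p < 8 ] stuck p X

  shares : ∀ p → 8 * sumOver (splittings U) (stuck p) ≡ 2 ^ length U
  shares p with L-three p ∈⊤
  ... | unique , length≡3 = subst (λ l → 2 ^ l * sumOver (splittings U) (stuck p) ≡ 2 ^ length U) length≡3
    (uniform-count (not (side p)) U (L p) unique λ e∈L → ∈-concat⁺′ e∈L (∈-map⁺ L (∈-allFin p)))

  average : sumOver (splittings U) stuck-count ≡ length (splittings U)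
  average = begin
    sumOver (splittings U) stuck-count            ≡⟨ sumOver-∑ (splittings U) stuck ⟩
    ∑[ p < 8 ] sumOver (splittings U) (stuck p)   ≡⟨ ∑-equal-shares (λ p → sumOver (splittings U) (stuck p))
                                                                      _ shares ⟩
    2 ^ length U                                  ≡⟨ length-splittings U ⟨
    length (splittings U)                         ∎
    where open ≡-Reasoning

  X₀ : ℕ → Bool
  X₀ = proj₁ (all-marked U)

  first-side-stuck : ∀ p → uniform true (L p) X₀ ≡ 1
  first-side-stuck p = cong indicator (all-true _ (L p) λ e∈L →
    cong (λ x → does (x ≟ᵇ true)) (proj₂ (proj₂ (all-marked U)) (∈-concat⁺′ e∈L (∈-map⁺ L (∈-allFin p)))))

  two-stuck : 2 ≤ stuck-count X₀
  two-stuck = two (first-side-stuck zero) (first-side-stuck (suc zero))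
    where
    two : ∀ {a b r} → a ≡ 1 → b ≡ 1 → 2 ≤ a + (b + r)
    two refl refl = s≤s (s≤s z≤n)

  good : ∃ λ X → X ∈ splittings U × stuck-count X ≡ 0
  good = average-one⇒zero (splittings U) stuck-count average (proj₁ (proj₂ (all-marked U))) two-stuck

  X : ℕ → Bool
  X = proj₁ good

  chosen : ∀ p → ∃ λ e → e ∈ L p × X e ≡ not (not (side p))
  chosen p = uniform≡0⇒ _ (L p) X (∑≡0⇒ (λ p → stuck p X) (proj₂ (proj₂ good)) p)

  c : Fin 8 → ℕ
  c p = proj₁ (chosen p)

  c∈L : ∀ p → c p ∈ L p
  c∈L p = proj₁ (proj₂ (chosen p))

  X-c : ∀ p → X (c p) ≡ side p
  X-c p = trans (proj₂ (proj₂ (chosen p))) (not-involutive (side p))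

  proper : ∀ p q → p ∈ₛ ⊤ → q ∈ₛ ⊤ → adj K44 p q ≡ true → c p ≢ c q
  proper p q _ _ pq cp≡cq =
    case trans (sym (xor-same (side q))) (trans (cong (_xor side q) (sym same-side)) pq) of λ ()
    where
    same-side : side p ≡ side q
    same-side = trans (sym (X-c p)) (trans (cong X cp≡cq) (X-c q))

-- Disjoint copies of a graph

-- In the disjoint union of r copies of H, vertex combine p i (with inverse remQuot r) is vertex p
-- of the i-th copy.
copiesAdj : ∀ {h r} → Graph h → Fin h × Fin r → Fin h × Fin r → Bool
copiesAdj H (p , i) (q , j) = does (i ≟ᶠ j) ∧ adj H p q

copiesAdj-sym : ∀ {h r} (H : Graph h) (x y : Fin h × Fin r) → copiesAdj H x y ≡ copiesAdj H y x
copiesAdj-sym H (p , i) (q , j) with i ≟ᶠ j | j ≟ᶠ i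
... | yes _ | yes _ = Graph.sym H p q
... | no _ | no _ = refl
... | yes i≡j | no j≢i = contradiction (sym i≡j) j≢i
... | no i≢j | yes j≡i = contradiction (sym j≡i) i≢j

copiesAdj-irrefl : ∀ {h r} (H : Graph h) (x : Fin h × Fin r) → copiesAdj H x x ≢ true
copiesAdj-irrefl H (p , i) with i ≟ᶠ i
... | yes _ = irrefl H p
... | no i≢i = contradiction refl i≢i

copies : ∀ {h} → Graph h → (r : ℕ) → Graph (h * r)
copies H r = record
  { adj = λ u v → copiesAdj H (remQuot r u) (remQuot r v)
  ; sym = λ u v → copiesAdj-sym H (remQuot r u) (remQuot r v)
  ; irrefl = λ v → copiesAdj-irrefl H (remQuot r v)
  }

copies-adj : ∀ {h} (H : Graph h) r p i q j →
  adj (copies H r) (combine p i) (combine q j) ≡ does (i ≟ᶠ j) ∧ adj H p q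
copies-adj H r p i q j = cong₂ (copiesAdj H) (remQuot-combine p i) (remQuot-combine q j)

slice : ∀ {h r} → Subset (h * r) → Fin r → Subset h
slice S i = tabulate (λ p → lookupᵛ S (combine p i))

slice-∈⁻ : ∀ {h r} {S : Subset (h * r)} {p : Fin h} {i : Fin r} → p ∈ₛ slice S i → combine p i ∈ₛ S
slice-∈⁻ {S = S} {p} {i} p∈ =
  lookup⇒[]= _ S (trans (sym (lookup∘tabulate (λ q → lookupᵛ S (combine q i)) p)) ([]=⇒lookup p∈))

slice-∈⁺ : ∀ {h r} {S : Subset (h * r)} {p : Fin h} {i : Fin r} → combine p i ∈ₛ S → p ∈ₛ slice S i
slice-∈⁺ {S = S} {p} {i} v∈S =
  lookup⇒[]= p (slice S i) (trans (lookup∘tabulate (λ q → lookupᵛ S (combine q i)) p) ([]=⇒lookup v∈S))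

combine-surjective : ∀ {h} r (v : Fin (h * r)) → ∃ λ p → ∃ λ i → combine p i ≡ v
combine-surjective {h} r v = proj₁ (remQuot {h} r v) , proj₂ (remQuot {h} r v) , combine-remQuot {h} r v

copies-choosable : ∀ {h k} r (H : Graph h) (S : Subset (h * r)) →
  (∀ i → InducedChoosable k H (slice S i)) → InducedChoosable k (copies H r) S
copies-choosable {h} r H S slices-choosable L L-ok = c , c∈L , proper
  where
  colouring : ∀ i → ListColouring H (slice S i) (λ p → L (combine p i))
  colouring i = slices-choosable i (λ p → L (combine p i)) (λ p p∈ → L-ok (combine p i) (slice-∈⁻ p∈))

  c : Fin (h * r) → ℕ
  c v = proj₁ (colouring (proj₂ (remQuot {h} r v))) (proj₁ (remQuot {h} r v))

  c-combine : ∀ p i → c (combine p i) ≡ proj₁ (colouring i) p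
  c-combine p i = cong (λ x → proj₁ (colouring (proj₂ x)) (proj₁ x)) (remQuot-combine p i)

  c∈L : ∀ v → v ∈ₛ S → c v ∈ L v
  c∈L v v∈S with combine-surjective {h} r v
  ... | p , i , refl rewrite c-combine p i = proj₁ (proj₂ (colouring i)) p (slice-∈⁺ v∈S)

  proper : ∀ u v → u ∈ₛ S → v ∈ₛ S → adj (copies H r) u v ≡ true → c u ≢ c v
  proper u v u∈S v∈S uv with combine-surjective {h} r u | combine-surjective {h} r v
  ... | p , i , refl | q , j , refl rewrite c-combine p i | c-combine q j | copies-adj H r p i q j with i ≟ᶠ j
  ...   | yes refl = proj₂ (proj₂ (colouring i)) p q (slice-∈⁺ u∈S) (slice-∈⁺ v∈S) uv
  ...   | no _ = case uv of λ ()

slice-choosable : ∀ {h k} r (H : Graph h) (S : Subset (h * r)) →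
  InducedChoosable k (copies H r) S → ∀ i → InducedChoosable k H (slice S i)
slice-choosable {h} {k} r H S choosable i ℓ ℓ-ok =
  (λ p → c (combine p i)) , c∈ℓ , λ p q p∈ q∈ pq →
    proper (combine p i) (combine q i) (slice-∈⁻ p∈) (slice-∈⁻ q∈)
      (trans (copies-adj H r p i q i) (i~i pq))
  where
  listAt : Fin h × Fin r → List ℕ
  listAt (p , j) with j ≟ᶠ i
  ... | yes _ = ℓ p
  ... | no _ = upTo k

  listAt-i : ∀ p → listAt (p , i) ≡ ℓ p
  listAt-i p with i ≟ᶠ i
  ... | yes _ = refl
  ... | no i≢i = contradiction refl i≢i

  listAt-ok : ∀ p j → combine p j ∈ₛ S → Unique (listAt (p , j)) × length (listAt (p , j)) ≡ k
  listAt-ok p j v∈S with j ≟ᶠ i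
  ... | yes refl = ℓ-ok p (slice-∈⁺ v∈S)
  ... | no _ = Uniqueₚ.upTo⁺ k , length-upTo k

  L : Fin (h * r) → List ℕ
  L v = listAt (remQuot r v)

  L-combine : ∀ p j → L (combine p j) ≡ listAt (p , j)
  L-combine p j = cong listAt (remQuot-combine p j)

  L-ok : IsKListAssignmentOn k S L
  L-ok v v∈S with combine-surjective {h} r v
  ... | p , j , refl = subst (λ l → Unique l × length l ≡ k) (sym (L-combine p j)) (listAt-ok p j v∈S)

  colouring : ListColouring (copies H r) S L
  colouring = choosable L L-ok

  c : Fin (h * r) → ℕ
  c = proj₁ colouring

  proper : ∀ u v → u ∈ₛ S → v ∈ₛ S → adj (copies H r) u v ≡ true → c u ≢ c v
  proper = proj₂ (proj₂ colouring)

  c∈ℓ : ∀ p → p ∈ₛ slice S i → c (combine p i) ∈ ℓ p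
  c∈ℓ p p∈ = subst (c (combine p i) ∈_) (trans (L-combine p i) (listAt-i p))
    (proj₁ (proj₂ colouring) (combine p i) (slice-∈⁻ p∈))

  i~i : ∀ {b} → b ≡ true → does (i ≟ᶠ i) ∧ b ≡ true
  i~i b≡true with i ≟ᶠ i
  ... | yes _ = b≡true
  ... | no i≢i = contradiction refl i≢i

slice-++ : ∀ {h r} (A : Subset r) (B : Subset (h * r)) i →
  slice {suc h} (A ++ᵛ B) i ≡ lookupᵛ A i ∷ slice {h} B i
slice-++ {h} A B i = cong₂ _∷_ (lookup-++ˡ A B i) (tabulate-cong λ p → lookup-++ʳ A B (combine p i))

∣S∣≡∑slices : ∀ {h r} (S : Subset (h * r)) → ∣ S ∣ ≡ ∑[ i < r ] ∣ slice {h} S i ∣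
∣S∣≡∑slices {zero} {r} [] = sym (sum-replicate-zero r)
∣S∣≡∑slices {suc h} {r} S with splitAtᵛ r S
... | A , B , refl = begin
  ∣ A ++ᵛ B ∣                                                    ≡⟨ ∣++∣ A B ⟩
  ∣ A ∣ + ∣ B ∣                                                   ≡⟨ cong₂ _+_ (∣p∣≡∑ A) (∣S∣≡∑slices {h} B) ⟩
  ∑[ i < r ] ∣ lookupᵛ A i ∷ [] ∣ + ∑[ i < r ] ∣ slice {h} B i ∣  ≡⟨ ∑-distrib-+ head-count tail-count ⟨
  ∑[ i < r ] (head-count i + tail-count i)                        ≡⟨ sum-cong-≗ slice-count ⟩
  ∑[ i < r ] ∣ slice {suc h} (A ++ᵛ B) i ∣                        ∎
  where
  open ≡-Reasoning
  head-count tail-count : Fin r → ℕ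
  head-count i = ∣ lookupᵛ A i ∷ [] ∣
  tail-count i = ∣ slice {h} B i ∣
  slice-count : ∀ i → head-count i + tail-count i ≡ ∣ slice {suc h} (A ++ᵛ B) i ∣
  slice-count i = sym (trans (cong ∣_∣ (slice-++ {h} A B i)) (∣∷∣ (lookupᵛ A i) (slice {h} B i)))

copies-bound : ∀ {h k c} r (H : Graph h) → (∀ T → InducedChoosable k H T → ∣ T ∣ ≤ c) →
  ∀ S → InducedChoosable k (copies H r) S → ∣ S ∣ ≤ c * r
copies-bound {h} {c = c} r H bound S choosable = begin
  ∣ S ∣                          ≡⟨ ∣S∣≡∑slices {h} S ⟩
  ∑[ i < r ] ∣ slice {h} S i ∣   ≤⟨ ∑-mono-≤ (λ i → bound _ (slice-choosable r H S choosable i)) ⟩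
  ∑[ i < r ] c                   ≡⟨ ∑-const r c ⟩
  r * c                          ≡⟨ *-comm r c ⟩
  c * r                          ∎
  where open ≤-Reasoning

inEveryCopy : ∀ {h} → Subset h → (r : ℕ) → Subset (h * r)
inEveryCopy {h} T r = tabulate (λ v → lookupᵛ T (proj₁ (remQuot {h} r v)))

slice-inEveryCopy : ∀ {h} (T : Subset h) r i → slice (inEveryCopy T r) i ≡ T
slice-inEveryCopy {h} T r i = trans (tabulate-cong λ p →
    trans (lookup∘tabulate (λ v → lookupᵛ T (proj₁ (remQuot {h} r v))) (combine p i))
          (cong (λ x → lookupᵛ T (proj₁ x)) (remQuot-combine p i)))
  (tabulate∘lookup T)

slice-⊤ : ∀ {h r} i → slice {h} {r} ⊤ i ≡ ⊤
slice-⊤ {h} {r} i = trans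
  (tabulate-cong λ p → trans (lookup-replicate (combine p i) true) (sym (lookup-replicate p true)))
  (tabulate∘lookup ⊤)

∣inEveryCopy∣ : ∀ {h} (T : Subset h) r → ∣ inEveryCopy T r ∣ ≡ ∣ T ∣ * r
∣inEveryCopy∣ {h} T r = begin
  ∣ inEveryCopy T r ∣                          ≡⟨ ∣S∣≡∑slices {h} (inEveryCopy T r) ⟩
  ∑[ i < r ] ∣ slice {h} (inEveryCopy T r) i ∣ ≡⟨ sum-cong-≗ (λ i → cong ∣_∣ (slice-inEveryCopy T r i)) ⟩
  ∑[ i < r ] ∣ T ∣                             ≡⟨ ∑-const r ∣ T ∣ ⟩
  r * ∣ T ∣                                    ≡⟨ *-comm r ∣ T ∣ ⟩
  ∣ T ∣ * r                                    ∎
  where open ≡-Reasoning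

copies-Choosable : ∀ {h k} r (H : Graph h) → Choosable k H → Choosable k (copies H r)
copies-Choosable r H choosable =
  copies-choosable r H ⊤ λ i → subst (InducedChoosable _ H) (sym (slice-⊤ i)) choosable

inEveryCopy-choosable : ∀ {h k} r (H : Graph h) T →
  InducedChoosable k H T → InducedChoosable k (copies H r) (inEveryCopy T r)
inEveryCopy-choosable r H T choosable =
  copies-choosable r H (inEveryCopy T r) λ i →
    subst (InducedChoosable _ H) (sym (slice-inEveryCopy T r i)) choosable

mainTheorem12 : (m : ℕ) →
    Σ (Graph (8 * suc m)) λ G →
      Choosable 3 G ×
      (Σ (Subset (8 * suc m)) λ S → InducedChoosable 2 G S × ∣ S ∣ ≡ 5 * suc m) ×
      (∀ (S : Subset (8 * suc m)) → InducedChoosable 2 G S → ∣ S ∣ ≤ 5 * suc m)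
mainTheorem12 m =
  copies K44 r ,
  copies-Choosable r K44 K44-3-choosable ,
  ( inEveryCopy K44-star r
  , inEveryCopy-choosable r K44 K44-star K44-star-2-choosable
  , ∣inEveryCopy∣ K44-star r ) ,
  copies-bound r K44 K44-2-choosable-bound
  where
  r : ℕ
  r = suc m
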